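{- Let $a,b,k\in\mathbb{Z}$ with $a\neq b$, and let $f(x)=(x+a)(x+a+k)(x+b)(x+b+k)$. For integers $d_1,d_2$ of the same parity with $d_1d_2=(ka-kb)^2$, set $$C=2ab+ka+kb-\frac{d_1+d_2}{2},\qquad \Delta=4\big((a+b+k)^2-2C\big).$$ Then every integer solution $(x_0,y_0)\in\mathbb{Z}^2$ of $y^2=f(x)$ is of the form $$(x_0,|y_0|)=\left(-\frac{a+b+k}{2}\pm\frac{\delta}{4},\ \left|\frac{d_1-d_2}{4}\right|\right)$$ for some such pair $d_1,d_2$ for which $\Delta=\delta^2$ with $\delta\in\mathbb{Z}$. In particular, if for a given pair $d_1,d_2$ the number $\Delta$ is not a perfect square, then no integer solution arises from that pair. -}

module Defs where

open import Data.Integer using (ℤ; _+_; _-_; _*_; -_; +_)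

f : ℤ → ℤ → ℤ → ℤ → ℤ
f a b k x = (x + a) * (x + a + k) * (x + b) * (x + b + k)

-- twice the paper's C:  2C = 2(2ab+ka+kb) - (d1+d2)
-- (C itself is an integer when d1,d2 have the same parity; we avoid division by 2)
twoC : ℤ → ℤ → ℤ → ℤ → ℤ → ℤ
twoC a b k d₁ d₂ = + 2 * (+ 2 * a * b + k * a + k * b) - (d₁ + d₂)

Δ : ℤ → ℤ → ℤ → ℤ → ℤ → ℤ
Δ a b k d₁ d₂ = + 4 * ((a + b + k) * (a + b + k) - twoC a b k d₁ d₂)

-- Pair the linear factors of f as P = (x+a)(x+b+k) and Q = (x+b)(x+a+k); their difference
-- P − Q = ka − kb does not depend on x.  From y² = PQ we get
-- (P + Q)² − (2|y|)² = (P + Q)² − 4PQ = (P − Q)² = (ka − kb)²,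
-- so d₁ = P + Q + 2|y|, d₂ = P + Q − 2|y| is an admissible pair with d₁ − d₂ = 4|y|.
-- Since d₁ + d₂ = 2(P + Q) = 4x² + 4(a+b+k)x + 2(2ab+ka+kb), the discriminant Δ of this pair
-- is the square of δ = 2(a+b+k) + 4x.
module Submission where

open import Defs
import Data.Nat as ℕ
import Data.Nat.Divisibility as ℕ
open import Data.Integer using (ℤ; _+_; _-_; _*_; -_; +_; ∣_∣; -[1+_])
open import Data.Integer.Divisibility using (_∣_)
open import Data.Integer.Properties using (pos-*)
open import Data.Integer.Tactic.RingSolver using (solve-∀)
open import Data.Product using (∃-syntax; _×_; _,_)
open import Data.Sum using (_⊎_; inj₁)
open import Relation.Binary.PropositionalEquality
  using (_≡_; _≢_; refl; sym; trans; cong; subst; module ≡-Reasoning)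

+∣i∣*+∣i∣≡i*i : ∀ i → + ∣ i ∣ * + ∣ i ∣ ≡ i * i
+∣i∣*+∣i∣≡i*i (+ n)    = refl
+∣i∣*+∣i∣≡i*i -[1+ n ] = refl

i≡-j+[j+i] : ∀ i j → i ≡ - j + (j + i)
i≡-j+[j+i] = solve-∀

[i+2j]-[i-2j]≡4j : ∀ i j → (i + + 2 * j) - (i - + 2 * j) ≡ + 4 * j
[i+2j]-[i-2j]≡4j = solve-∀

[i+2j]*[i-2j]≡i²-4j² : ∀ i j → (i + + 2 * j) * (i - + 2 * j) ≡ i * i - + 4 * (j * j)
[i+2j]*[i-2j]≡i²-4j² = solve-∀

[i+j]²-4ij≡[i-j]² : ∀ i j → (i + j) * (i + j) - + 4 * (i * j) ≡ (i - j) * (i - j)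
[i+j]²-4ij≡[i-j]² = solve-∀

f≡[x+a][x+b+k]*[x+b][x+a+k] : ∀ a b k x →
  f a b k x ≡ (x + a) * (x + b + k) * ((x + b) * (x + a + k))
f≡[x+a][x+b+k]*[x+b][x+a+k] a b k x = rearrange (x + a) (x + a + k) (x + b) (x + b + k)
  where
  rearrange : ∀ i j l m → i * j * l * m ≡ i * m * (l * j)
  rearrange = solve-∀

[x+a][x+b+k]-[x+b][x+a+k]≡ka-kb : ∀ a b k x →
  (x + a) * (x + b + k) - (x + b) * (x + a + k) ≡ k * a - k * b
[x+a][x+b+k]-[x+b][x+a+k]≡ka-kb = solve-∀

Δ-at-factor-sum : ∀ a b k x t →
  let σ = (x + a) * (x + b + k) + (x + b) * (x + a + k)
      δ = + 2 * (a + b + k) + + 4 * x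
  in Δ a b k (σ + t) (σ - t) ≡ δ * δ
Δ-at-factor-sum = unfolded
  where
  unfolded : ∀ a b k x t →
    let s = a + b + k
        σ = (x + a) * (x + b + k) + (x + b) * (x + a + k)
    in + 4 * (s * s - (+ 2 * (+ 2 * a * b + k * a + k * b) - ((σ + t) + (σ - t))))
       ≡ (+ 2 * s + + 4 * x) * (+ 2 * s + + 4 * x)
  unfolded = solve-∀

proposition1 : (a b k : ℤ) → a ≢ b → (x₀ y₀ : ℤ) → y₀ * y₀ ≡ f a b k x₀ →
    ∃[ d₁ ] ∃[ d₂ ] ∃[ δ ]
      (+ 2 ∣ (d₁ - d₂))
      × (d₁ * d₂ ≡ (k * a - k * b) * (k * a - k * b))
      × (Δ a b k d₁ d₂ ≡ δ * δ)
      × ((+ 4 * x₀ ≡ - (+ 2 * (a + b + k)) + δ) ⊎ (+ 4 * x₀ ≡ - (+ 2 * (a + b + k)) - δ))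
      × (+ 4 * + ∣ y₀ ∣ ≡ + ∣ d₁ - d₂ ∣)
proposition1 a b k _ x y y²≡f =
  d₁ , d₂ , + 2 * (a + b + k) + + 4 * x ,
  two∣d₁-d₂ , d₁d₂≡[ka-kb]² , Δ-at-factor-sum a b k x (+ 2 * Y) ,
  inj₁ (i≡-j+[j+i] (+ 4 * x) (+ 2 * (a + b + k))) , 4∣y∣≡∣d₁-d₂∣
  where
  P = (x + a) * (x + b + k)
  Q = (x + b) * (x + a + k)
  n = ∣ y ∣
  Y = + n
  d₁ = P + Q + + 2 * Y
  d₂ = P + Q - + 2 * Y

  d₁-d₂≡4n : d₁ - d₂ ≡ + (4 ℕ.* n)
  d₁-d₂≡4n = trans ([i+2j]-[i-2j]≡4j (P + Q) Y) (sym (pos-* 4 n))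

  two∣d₁-d₂ : + 2 ∣ (d₁ - d₂)
  two∣d₁-d₂ = subst (+ 2 ∣_) (sym d₁-d₂≡4n) (ℕ.∣m⇒∣m*n n (ℕ.divides 2 refl))

  4∣y∣≡∣d₁-d₂∣ : + 4 * Y ≡ + ∣ d₁ - d₂ ∣
  4∣y∣≡∣d₁-d₂∣ = trans (sym (pos-* 4 n)) (cong (λ i → + ∣ i ∣) (sym d₁-d₂≡4n))

  Y²≡PQ : Y * Y ≡ P * Q
  Y²≡PQ = trans (+∣i∣*+∣i∣≡i*i y) (trans y²≡f (f≡[x+a][x+b+k]*[x+b][x+a+k] a b k x))

  d₁d₂≡[ka-kb]² : d₁ * d₂ ≡ (k * a - k * b) * (k * a - k * b)
  d₁d₂≡[ka-kb]² = begin
    d₁ * d₂                              ≡⟨ [i+2j]*[i-2j]≡i²-4j² (P + Q) Y ⟩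
    (P + Q) * (P + Q) - + 4 * (Y * Y)    ≡⟨ cong (λ i → (P + Q) * (P + Q) - + 4 * i) Y²≡PQ ⟩
    (P + Q) * (P + Q) - + 4 * (P * Q)    ≡⟨ [i+j]²-4ij≡[i-j]² P Q ⟩
    (P - Q) * (P - Q)                    ≡⟨ cong (λ i → i * i) ([x+a][x+b+k]-[x+b][x+a+k]≡ka-kb a b k x) ⟩
    (k * a - k * b) * (k * a - k * b)    ∎
    where open ≡-Reasoning
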